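{- Let $Q=(q_n)_{n\ge1}$ be a basic sequence that is infinite in limit. For every $F\in\Gamma_Q$ there exists a sequence $F_1,F_2,F_3,\dots$ of elements of $\Gamma_Q$ such that $F_n\ne F$ for all $n$ and $\lim_{n\to\infty}d(F,F_n)=0$.
   Context: A basic sequence is a sequence $Q=(q_n)_{n\ge1}$ of integers with $q_n\ge 2$; it is infinite in limit if $q_n\to\infty$. For each positive integer $j$ let $\nu_j=\min\{N: q_m\ge 2j^2 \text{ for all } m\ge N\}$. Let $l_1=\max(\nu_2-1,1)$ and, recursively for $i\ge2$, let $l_i$ be the smallest positive integer $k$ with $l_1+2l_2+\cdots+(i-1)l_{i-1}+ik\ge \nu_{i+1}-1$. Put $L_0=0$, $L_i=\sum_{j=1}^i jl_j$. Let $\mathbb N=\{1,2,\dots\}$, $S_Q=\{(a,b,c)\in\mathbb N^3: b\le l_a,\ c\le a\}$ and $\phi_Q(a,b,c)=L_{a-1}+(b-1)a+c$ (a bijection $S_Q\to\mathbb N$). A $Q$-special sequence is a family of integers $F=(F_{(a,b,c)})_{(a,b,c)\in S_Q}$ with $F_{(a,b,1)}=0$ for all $(a,b,1)\in S_Q$, and $\frac{F_{(a,b,c)}}{q_{\phi_Q(a,b,c)}}\in\left[\frac{c-1}{a}-\frac{1}{2a^2},\frac{c-1}{a}+\frac{1}{2a^2}\right]$ for $(a,b,c)\in S_Q$ with $c>1$. Let $\Gamma_Q$ be the set of $Q$-special sequences; for $F\in\Gamma_Q$ put $E_{F,n}=F_{\phi_Q^{ -1}(n)}$. For $F_1\ne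 F_2$ in $\Gamma_Q$ let $\zeta_{F_1,F_2}=\min\{n: E_{F_1,n}\ne E_{F_2,n}\}$ and $d(F_1,F_2)=\frac{1}{q_1q_2\cdots q_{\zeta_{F_1,F_2}-1}}$ (empty product $=1$); let $d(F,F)=0$. -}

module Defs where

open import Data.Nat using (ℕ; zero; suc; _+_; _*_; _∸_; _≤_; _<_; _⊔_)
open import Data.Integer using (ℤ; +_)
open import Data.Rational using (ℚ; _/_; 0ℚ) renaming (_-_ to _-ℚ_; _+_ to _+ℚ_; _≤_ to _≤ℚ_)
open import Data.Product using (Σ; ∃-syntax; _×_)
open import Relation.Binary.PropositionalEquality using (_≡_; _≢_)

-- Sequences are indexed from 1: q : ℕ → ℕ, the value q 0 is irrelevant.

IsBasic : (ℕ → ℕ) → Set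
IsBasic q = ∀ n → 1 ≤ n → 2 ≤ q n

InfiniteInLimit : (ℕ → ℕ) → Set
InfiniteInLimit q = ∀ M → ∃[ N ] (∀ n → N ≤ n → M ≤ q n)

IsNu : (ℕ → ℕ) → (ℕ → ℕ) → Set
IsNu q ν = ∀ j → 1 ≤ j →
    (1 ≤ ν j)
  × (∀ m → ν j ≤ m → 2 * (j * j) ≤ q m)
  × (∀ N → 1 ≤ N → (∀ m → N ≤ m → 2 * (j * j) ≤ q m) → ν j ≤ N)

L : (ℕ → ℕ) → ℕ → ℕ
L l zero = 0
L l (suc i) = L l i + suc i * l (suc i)

IsL : (ℕ → ℕ) → (ℕ → ℕ) → Set
IsL ν l =
    (l 1 ≡ (ν 2 ∸ 1) ⊔ 1)
  × (∀ i → 2 ≤ i →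
        (1 ≤ l i)
      × (ν (suc i) ∸ 1 ≤ L l (i ∸ 1) + i * l i)
      × (∀ k → 1 ≤ k → ν (suc i) ∸ 1 ≤ L l (i ∸ 1) + i * k → l i ≤ k))

record SQ (l : ℕ → ℕ) : Set where
  constructor triple
  field
    a b c : ℕ
    1≤b : 1 ≤ b
    b≤la : b ≤ l a
    1≤c : 1 ≤ c
    c≤a : c ≤ a
open SQ public

φ : (l : ℕ → ℕ) → SQ l → ℕ
φ l s = L l (a s ∸ 1) + (b s ∸ 1) * a s + c s

-- x / n as a rational; only used with n ≥ 1 (the n = 0 case is a dummy).
_÷ℕ_ : ℤ → ℕ → ℚ
x ÷ℕ zero = 0ℚ
x ÷ℕ suc n = x / suc n

IsSpecial : (q : ℕ → ℕ) (l : ℕ → ℕ) → (SQ l → ℤ) → Set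
IsSpecial q l F = ∀ (s : SQ l) →
    (c s ≡ 1 → F s ≡ + 0)
  × (1 < c s →
        (((+ (c s ∸ 1)) ÷ℕ a s) -ℚ ((+ 1) ÷ℕ (2 * (a s * a s)))
            ≤ℚ (F s ÷ℕ q (φ l s)))
      × ((F s ÷ℕ q (φ l s))
            ≤ℚ (((+ (c s ∸ 1)) ÷ℕ a s) +ℚ ((+ 1) ÷ℕ (2 * (a s * a s))))))

Γ : (q : ℕ → ℕ) (l : ℕ → ℕ) → Set
Γ q l = Σ (SQ l → ℤ) (IsSpecial q l)

-- ζ_{F1,F2} = min { n : E_{F1,n} ≠ E_{F2,n} }, where E_{F,n} = F_{φ⁻¹(n)}
IsZeta : (l : ℕ → ℕ) → (SQ l → ℤ) → (SQ l → ℤ) → ℕ → Set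
IsZeta l F₁ F₂ z =
    (∃[ s ] ((φ l s ≡ z) × (F₁ s ≢ F₂ s)))
  × (∀ s → φ l s < z → F₁ s ≡ F₂ s)

prodQ : (ℕ → ℕ) → ℕ → ℕ
prodQ q zero = 1
prodQ q (suc k) = prodQ q k * q (suc k)

dist : (ℕ → ℕ) → ℕ → ℚ
dist q z = (+ 1) ÷ℕ prodQ q (z ∸ 1)

module Submission where

-- At a position s = (a,b,c) with c ≥ 2 the entry F_s is an integer
-- x with x/q ∈ [r - 1/(2a²), r + 1/(2a²)], where q = q_{φ(s)} ≥ 2a² by the
-- choice of the ν's and l's.  That interval is at least 2/q wide, so one of
-- x - 1, x + 1 lies in it as well.  Replacing F_s by such a neighbour at the
-- single position of index z = φ(s) gives a special sequence G ≠ F that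
-- agrees with F before z, so ζ_{F,G} = z and d(F,G) = 1/(q_1⋯q_{z-1}).
-- Taking s = (n+2, 1, 2) makes z ≥ n + 1, and since every q_i ≥ 2 the
-- product q_1⋯q_{z-1} exceeds z - 1; hence d(F,G_n) → 0.

open import Defs
open import Data.Nat as ℕ using (ℕ; zero; suc; z≤n; s≤s; _≤_)
import Data.Nat.Properties as ℕP
open import Data.Integer as ℤ using (ℤ; +_)
import Data.Integer.Properties as ℤP
open import Data.Integer.Solver using (module +-*-Solver)
open import Data.Rational as ℚ using (ℚ; 0ℚ; mkℚ; _<_; toℚᵘ)
import Data.Rational.Properties as ℚP
import Data.Rational.Solver as ℚSolver
import Data.Rational.Unnormalised as U
import Data.Rational.Unnormalised.Properties as UP
open import Data.Product using (Σ; ∃-syntax; _×_; _,_; proj₁; proj₂)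
open import Data.Empty using (⊥-elim)
open import Function using (_∘_)
open import Relation.Nullary using (yes; no; _×-dec_)
open import Relation.Binary.PropositionalEquality

÷ℕ-toℚᵘ : ∀ x m → toℚᵘ (x ÷ℕ suc m) U.≃ U.mkℚᵘ x m
÷ℕ-toℚᵘ x m = ℚP.toℚᵘ-fromℚᵘ (U.mkℚᵘ x m)

÷ℕ-≤ : ∀ x y m n → 1 ℕ.≤ m → 1 ℕ.≤ n →
  x ℤ.* + n ℤ.≤ y ℤ.* + m → x ÷ℕ m ℚ.≤ y ÷ℕ n
÷ℕ-≤ x y (suc m) (suc n) _ _ h = ℚP.toℚᵘ-cancel-≤
  (UP.≤-respˡ-≃ (UP.≃-sym (÷ℕ-toℚᵘ x m)) (UP.≤-respʳ-≃ (UP.≃-sym (÷ℕ-toℚᵘ y n)) (U.*≤* h)))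

÷ℕ-< : ∀ x y m n → 1 ℕ.≤ m → 1 ℕ.≤ n →
  x ℤ.* + n ℤ.< y ℤ.* + m → x ÷ℕ m ℚ.< y ÷ℕ n
÷ℕ-< x y (suc m) (suc n) _ _ h = ℚP.toℚᵘ-cancel-<
  (UP.<-respˡ-≃ (UP.≃-sym (÷ℕ-toℚᵘ x m)) (UP.<-respʳ-≃ (UP.≃-sym (÷ℕ-toℚᵘ y n)) (U.*<* h)))

÷ℕ-mono : ∀ {x y} n → 1 ℕ.≤ n → x ℤ.≤ y → x ÷ℕ n ℚ.≤ y ÷ℕ n
÷ℕ-mono {x} {y} n 1≤n x≤y = ÷ℕ-≤ x y n n 1≤n 1≤n (ℤP.*-monoʳ-≤-nonNeg (+ n) x≤y)

÷ℕ-+ : ∀ x y n → 1 ℕ.≤ n → (x ℤ.+ y) ÷ℕ n ≡ x ÷ℕ n ℚ.+ y ÷ℕ n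
÷ℕ-+ x y (suc m) _ = ℚP.toℚᵘ-injective (UP.≃-sym
  (UP.≃-trans (ℚP.toℚᵘ-homo-+ (x ÷ℕ suc m) (y ÷ℕ suc m))
  (UP.≃-trans (UP.+-cong (÷ℕ-toℚᵘ x m) (÷ℕ-toℚᵘ y m))
  (UP.≃-trans sameDenominator (UP.≃-sym (÷ℕ-toℚᵘ (x ℤ.+ y) m))))))
  where
  open +-*-Solver
  distrib : ∀ a b c → (a ℤ.* c ℤ.+ b ℤ.* c) ℤ.* c ≡ (a ℤ.+ b) ℤ.* (c ℤ.* c)
  distrib = solve 3 (λ a b c → (a :* c :+ b :* c) :* c := (a :+ b) :* (c :* c)) refl
  sameDenominator : (U.mkℚᵘ x m U.+ U.mkℚᵘ y m) U.≃ U.mkℚᵘ (x ℤ.+ y) m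
  sameDenominator = U.*≡* (trans (distrib x y (+ suc m))
    (cong ((x ℤ.+ y) ℤ.*_) (sym (ℤP.pos-* (suc m) (suc m)))))

neighbour : ∀ lo hi x n → 1 ℕ.≤ n → (+ 2) ÷ℕ n ℚ.+ lo ℚ.≤ hi →
  lo ℚ.≤ x ÷ℕ n → x ÷ℕ n ℚ.≤ hi →
  Σ ℤ λ y → y ≢ x × lo ℚ.≤ y ÷ℕ n × y ÷ℕ n ℚ.≤ hi
neighbour lo hi x n 1≤n wide lo≤x x≤hi with lo ℚP.≤? ℤ.pred x ÷ℕ n
... | yes lo≤pred = ℤ.pred x , pred≢x , lo≤pred , ℚP.≤-trans (÷ℕ-mono n 1≤n pred≤x) x≤hi
  where
  pred≢x : ℤ.pred x ≢ x
  pred≢x eq = ℤP.i≢suc[i] (trans eq (sym (ℤP.suc-pred x)))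
  pred≤x : ℤ.pred x ℤ.≤ x
  pred≤x = subst (ℤ.pred x ℤ.≤_) (ℤP.suc-pred x) (ℤP.i≤suc[i] (ℤ.pred x))
... | no lo≰pred = ℤ.suc x , ℤP.i≢suc[i] ∘ sym , ℚP.≤-trans lo≤x (÷ℕ-mono n 1≤n (ℤP.i≤suc[i] x)) ,
                   ℚP.<⇒≤ (ℚP.<-≤-trans suc<2+lo wide)
  where
  open +-*-Solver
  twoSteps : ∀ x → ℤ.suc x ≡ + 2 ℤ.+ ℤ.pred x
  twoSteps = solve 1 (λ x → con (+ 1) :+ x := con (+ 2) :+ (con (ℤ.- + 1) :+ x)) refl
  -- (x+1)/n = 2/n + (x-1)/n and (x-1)/n < lo
  suc<2+lo : ℤ.suc x ÷ℕ n ℚ.< (+ 2) ÷ℕ n ℚ.+ lo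
  suc<2+lo = subst (ℚ._< (+ 2) ÷ℕ n ℚ.+ lo)
    (sym (trans (cong (_÷ℕ n) (twoSteps x)) (÷ℕ-+ (+ 2) (ℤ.pred x) n 1≤n)))
    (ℚP.+-monoʳ-< ((+ 2) ÷ℕ n) (ℚP.≰⇒> lo≰pred))

room : ∀ r w e → e ℚ.≤ w ℚ.+ w → e ℚ.+ (r ℚ.- w) ℚ.≤ r ℚ.+ w
room r w e e≤2w = ℚP.≤-trans (ℚP.+-monoˡ-≤ (r ℚ.- w) e≤2w) (ℚP.≤-reflexive (regroup r w))
  where
  open ℚSolver.+-*-Solver
  regroup : ∀ r w → (w ℚ.+ w) ℚ.+ (r ℚ.- w) ≡ r ℚ.+ w
  regroup = solve 2 (λ r w → (w :+ w) :+ (r :- w) := r :+ w) refl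

two-over-≤ : ∀ m n → 1 ℕ.≤ m → m ℕ.≤ n → (+ 2) ÷ℕ n ℚ.≤ (+ 1) ÷ℕ m ℚ.+ (+ 1) ÷ℕ m
two-over-≤ m n 1≤m m≤n = subst ((+ 2) ÷ℕ n ℚ.≤_) (÷ℕ-+ (+ 1) (+ 1) m 1≤m)
  (÷ℕ-≤ (+ 2) (+ 2) n m (ℕP.≤-trans 1≤m m≤n) 1≤m
    (ℤP.*-monoˡ-≤-nonNeg (+ 2) (ℤ.+≤+ m≤n)))

prodQ-grows : ∀ q → IsBasic q → ∀ k → suc k ℕ.≤ prodQ q k
prodQ-grows q basic zero = s≤s z≤n
prodQ-grows q basic (suc k) = ℕP.≤-trans (s≤s (s≤s (ℕP.m≤m*n k 2)))
  (ℕP.*-mono-≤ (prodQ-grows q basic k) (basic (suc k) (s≤s z≤n)))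

prodQ-small : ∀ q → IsBasic q → ∀ ε → 0ℚ < ε →
  ∀ k → ℚ.↧ₙ ε ℕ.≤ k → (+ 1) ÷ℕ prodQ q k < ε
prodQ-small q basic (mkℚ (+ zero) _ _) (ℚ.*<* 0<0) k _ = ⊥-elim (ℤP.<-irrefl refl 0<0)
prodQ-small q basic (mkℚ ℤ.-[1+ _ ] _ _) (ℚ.*<* ()) k _
prodQ-small q basic ε@(mkℚ (+ suc m) d-1 _) _ k d≤k =
  subst ((+ 1) ÷ℕ P <_) (ℚP.↥p/↧p≡p ε)
    (÷ℕ-< (+ 1) (+ suc m) P (suc d-1) 1≤P (s≤s z≤n)
      (subst₂ ℤ._<_ (sym (ℤP.*-identityˡ (+ suc d-1))) (ℤP.pos-* (suc m) P)
        (ℤ.+<+ (ℕP.<-≤-trans d<P (ℕP.m≤n*m P (suc m))))))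
  where
  P = prodQ q k
  d<P : suc d-1 ℕ.< P
  d<P = ℕP.≤-trans (s≤s d≤k) (prodQ-grows q basic k)
  1≤P : 1 ℕ.≤ P
  1≤P = ℕP.≤-trans (s≤s z≤n) (prodQ-grows q basic k)

module Indexing (q : ℕ → ℕ) (ν : ℕ → ℕ) (isNu : IsNu q ν) (l : ℕ → ℕ) (isL : IsL ν l) where

  l-pos : ∀ i → 1 ℕ.≤ i → 1 ℕ.≤ l i
  l-pos (suc zero) _ rewrite proj₁ isL = ℕP.m≤n⊔m (ν 2 ℕ.∸ 1) 1
  l-pos (suc (suc i)) _ = proj₁ (proj₂ isL (suc (suc i)) (s≤s (s≤s z≤n)))

  L-grows : ∀ i → i ℕ.≤ L l i
  L-grows zero = z≤n
  L-grows (suc i) = ℕP.≤-trans (ℕP.≤-reflexive (ℕP.+-comm 1 i))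
    (ℕP.+-mono-≤ (L-grows i) (ℕP.≤-trans (l-pos (suc i) (s≤s z≤n)) (ℕP.m≤n*m (l (suc i)) (suc i))))

  ν-below-L : ∀ a → 2 ℕ.≤ a → ν a ℕ.∸ 1 ℕ.≤ L l (a ℕ.∸ 1)
  ν-below-L (suc zero) (s≤s ())
  ν-below-L (suc (suc zero)) _ = ℕP.≤-trans (ℕP.m≤m⊔n (ν 2 ℕ.∸ 1) 1)
    (ℕP.≤-reflexive (trans (sym (proj₁ isL)) (sym (ℕP.*-identityˡ (l 1)))))
  ν-below-L (suc (suc (suc j))) _ = proj₁ (proj₂ (proj₂ isL (suc (suc j)) (s≤s (s≤s z≤n))))

  L-below-φ : ∀ s → L l (a s ℕ.∸ 1) ℕ.≤ φ l s ℕ.∸ 1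
  L-below-φ s = ℕP.≤-trans (ℕP.≤-trans (ℕP.m≤m+n (L l (a s ℕ.∸ 1)) _) (ℕP.m≤m+n X (c s ℕ.∸ 1)))
    (ℕP.≤-reflexive (sym (ℕP.+-∸-assoc X (1≤c s))))
    where X = L l (a s ℕ.∸ 1) ℕ.+ (b s ℕ.∸ 1) ℕ.* a s

  q-large : ∀ s → 2 ℕ.≤ c s → 2 ℕ.* (a s ℕ.* a s) ℕ.≤ q (φ l s)
  q-large s 2≤c = proj₁ (proj₂ (isNu (a s) 1≤a)) (φ l s) νa≤φ
    where
    2≤a = ℕP.≤-trans 2≤c (c≤a s)
    1≤a = ℕP.≤-trans (s≤s z≤n) 2≤a
    νa≤φ : ν (a s) ℕ.≤ φ l s
    νa≤φ = ℕP.≤-trans (ℕP.≤-reflexive (sym (ℕP.m∸n+n≡m (proj₁ (isNu (a s) 1≤a)))))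
      (ℕP.+-mono-≤ (ℕP.≤-trans (ν-below-L (a s) 2≤a) (ℕP.m≤m+n _ _)) (1≤c s))

  probe : ℕ → SQ l
  probe n = triple (suc (suc n)) 1 2 (s≤s z≤n) (l-pos (suc (suc n)) (s≤s z≤n)) (s≤s z≤n) (s≤s (s≤s z≤n))

  probe-far : ∀ n → n ℕ.≤ φ l (probe n) ℕ.∸ 1
  probe-far n = ℕP.≤-trans (ℕP.n≤1+n n) (ℕP.≤-trans (L-grows (suc n)) (L-below-φ (probe n)))

  module Perturbation (f : SQ l → ℤ) (special : IsSpecial q l f) where

    centre radius : SQ l → ℚ
    centre s = (+ (c s ℕ.∸ 1)) ÷ℕ a s
    radius s = (+ 1) ÷ℕ (2 ℕ.* (a s ℕ.* a s))

    Admissible : SQ l → ℤ → Set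
    Admissible s y = (centre s ℚ.- radius s ℚ.≤ y ÷ℕ q (φ l s))
                   × (y ÷ℕ q (φ l s) ℚ.≤ centre s ℚ.+ radius s)

    alternative : ∀ s → 2 ℕ.≤ c s → Σ ℤ λ y → y ≢ f s × Admissible s y
    alternative s 2≤c =
      neighbour (centre s ℚ.- radius s) (centre s ℚ.+ radius s) (f s) (q (φ l s)) 1≤q
        (room (centre s) (radius s) _ (two-over-≤ M (q (φ l s)) 1≤M (q-large s 2≤c)))
        (proj₁ (proj₂ (special s) 2≤c)) (proj₂ (proj₂ (special s) 2≤c))
      where
      M = 2 ℕ.* (a s ℕ.* a s)
      -- a ≥ c ≥ 2, so M = 2a² is positive
      1≤M : 1 ℕ.≤ M
      1≤M with a s | ℕP.≤-trans 2≤c (c≤a s)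
      ... | suc _ | _ = s≤s z≤n
      1≤q = ℕP.≤-trans 1≤M (q-large s 2≤c)

    -- f with the alternative value at every position of index z with c ≥ 2
    -- (φ being a bijection, that is at most one position).
    perturb : ℕ → SQ l → ℤ
    perturb z s with (φ l s ℕ.≟ z) ×-dec (2 ℕ.≤? c s)
    ... | yes (_ , 2≤c) = proj₁ (alternative s 2≤c)
    ... | no _ = f s

    perturb-special : ∀ z → IsSpecial q l (perturb z)
    perturb-special z s with (φ l s ℕ.≟ z) ×-dec (2 ℕ.≤? c s)
    ... | yes (_ , 2≤c) = (λ c≡1 → ⊥-elim (ℕP.<-irrefl (sym c≡1) 2≤c)) ,
                          (λ _ → proj₂ (proj₂ (alternative s 2≤c)))
    ... | no _ = special s

    perturb-moves : ∀ s → 2 ℕ.≤ c s → f s ≢ perturb (φ l s) s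
    perturb-moves s 2≤c with (φ l s ℕ.≟ φ l s) ×-dec (2 ℕ.≤? c s)
    ... | yes (_ , 2≤c′) = λ eq → proj₁ (proj₂ (alternative s 2≤c′)) (sym eq)
    ... | no off = ⊥-elim (off (refl , 2≤c))

    perturb-fixes : ∀ z s → φ l s ≢ z → f s ≡ perturb z s
    perturb-fixes z s φ≢z with (φ l s ℕ.≟ z) ×-dec (2 ℕ.≤? c s)
    ... | yes (φ≡z , _) = ⊥-elim (φ≢z φ≡z)
    ... | no _ = refl

    perturb-zeta : ∀ s → 2 ℕ.≤ c s → IsZeta l f (perturb (φ l s)) (φ l s)
    perturb-zeta s 2≤c = (s , refl , perturb-moves s 2≤c) ,
                         λ t t<s → perturb-fixes (φ l s) t (ℕP.<⇒≢ t<s)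

mainTheorem18 : (q : ℕ → ℕ) → IsBasic q → InfiniteInLimit q →
    (ν : ℕ → ℕ) → IsNu q ν → (l : ℕ → ℕ) → IsL ν l →
    (F : Γ q l) →
    Σ (ℕ → Γ q l) λ Fs →
        (∀ n → 1 ≤ n → proj₁ (Fs n) ≢ proj₁ F)
      × (∀ (ε : ℚ) → 0ℚ < ε → ∃[ N ] (∀ n → N ≤ n →
            ∃[ z ] (IsZeta l (proj₁ F) (proj₁ (Fs n)) z × (dist q z < ε))))
mainTheorem18 q basic _ ν isNu l isL (f , special) =
  Fs , differs , converges
  where
  open Indexing q ν isNu l isL
  open Perturbation f special

  z : ℕ → ℕ
  z n = φ l (probe n)

  Fs : ℕ → Γ q l
  Fs n = perturb (z n) , perturb-special (z n)

  differs : ∀ n → 1 ≤ n → perturb (z n) ≢ f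
  differs n _ eq = perturb-moves (probe n) (s≤s (s≤s z≤n)) (sym (cong (λ g → g (probe n)) eq))

  converges : ∀ ε → 0ℚ < ε → ∃[ N ] (∀ n → N ≤ n →
    ∃[ y ] (IsZeta l f (perturb (z n)) y × dist q y < ε))
  converges ε 0<ε = ℚ.↧ₙ ε , λ n N≤n →
    z n , perturb-zeta (probe n) (s≤s (s≤s z≤n)) ,
    prodQ-small q basic ε 0<ε (z n ℕ.∸ 1) (ℕP.≤-trans N≤n (probe-far n))
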